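{- Let $n \ge 2$ be an integer such that $\{\log_2(3n)\} < 1 - \{\log_2 3\}$ or $\{\log_2(3n)\} \ge \{\log_2 3\}$. Then $\mathsf{D}_{\pm}(C_3 \oplus C_{3n}) = \lfloor \log_2(9n) \rfloor + 1$.
   Context: $C_m$ denotes a cyclic group of order $m$; $\{x\} = x - \lfloor x\rfloor$ is the fractional part. For a finite abelian group $G$ (written additively), $\mathsf{D}_{\pm}(G)$ is the smallest positive integer $\ell$ such that for every sequence $g_1,\dots,g_k$ of elements of $G$ (repetitions allowed) with $k \ge \ell$ there exist a non-empty subset $I \subset \{1,\dots,k\}$ and $a_i \in \{+1,-1\}$ ($i\in I$) with $\sum_{i \in I} a_i g_i = 0$. -}

module Defs where

open import Data.Nat using (ℕ; zero; suc; _*_; _+_; _≤_; _<_; _^_; NonZero)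
open import Data.Nat.Logarithm using (⌊log₂_⌋)
open import Data.Integer as ℤ using (ℤ; +_)
open import Data.Integer.Divisibility using () renaming (_∣_ to _∣ℤ_)
open import Data.Fin using (Fin; toℕ)
import Data.Fin as F
open import Data.Fin.Subset using (Subset; Nonempty; _∈_)
open import Data.Vec using (lookup)
open import Data.Bool using (Bool; true; false; if_then_else_)
open import Data.Product using (_×_; _,_; proj₁; proj₂; ∃)
open import Data.Sum using (_⊎_)
open import Relation.Nullary using (¬_)

Σℤ : ∀ {k} → (Fin k → ℤ) → ℤ
Σℤ {zero} f = + 0
Σℤ {suc k} f = f F.zero ℤ.+ Σℤ (λ i → f (F.suc i))

-- The group C_m1 ⊕ C_m2, realised as ℤ/m1 × ℤ/m2 with canonical
-- representatives Fin m1 × Fin m2.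
Elem : ℕ → ℕ → Set
Elem m1 m2 = Fin m1 × Fin m2

coef : ∀ {k} → Subset k → (Fin k → Bool) → Fin k → ℤ
coef I ε i = if lookup I i then (if ε i then + 1 else ℤ.- (+ 1)) else + 0

SignedZeroSum : ∀ {m1 m2 k} → (Fin k → Elem m1 m2) → Subset k → (Fin k → Bool) → Set
SignedZeroSum {m1} {m2} g I ε =
  ((+ m1) ∣ℤ Σℤ (λ i → coef I ε i ℤ.* (+ toℕ (proj₁ (g i)))))
  × ((+ m2) ∣ℤ Σℤ (λ i → coef I ε i ℤ.* (+ toℕ (proj₂ (g i)))))

HasPMZeroSum : ∀ {m1 m2 k} → (Fin k → Elem m1 m2) → Set
HasPMZeroSum g = ∃ λ I → Nonempty I × ∃ λ ε → SignedZeroSum g I ε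

PMProperty : ℕ → ℕ → ℕ → Set
PMProperty m1 m2 ℓ = ∀ k → ℓ ≤ k → (g : Fin k → Elem m1 m2) → HasPMZeroSum g

IsDpm : ℕ → ℕ → ℕ → Set
IsDpm m1 m2 ℓ = (1 ≤ ℓ) × PMProperty m1 m2 ℓ × (∀ ℓ' → 1 ≤ ℓ' → ℓ' < ℓ → ¬ PMProperty m1 m2 ℓ')

-- Integer form of the hypothesis on fractional parts. With k = ⌊log₂(3n)⌋:
--   {log₂(3n)} < 1 - {log₂ 3}  ⟺  log₂(9n) < k + 2  ⟺  9n < 2^(k+2)
--   {log₂(3n)} ≥ {log₂ 3}      ⟺  log₂(2n) ≥ k      ⟺  2^k ≤ 2n
FracCond : ℕ → Set
FracCond n = (9 * n < 2 ^ (⌊log₂ (3 * n) ⌋ + 2)) ⊎ (2 ^ ⌊log₂ (3 * n) ⌋ ≤ 2 * n)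

-- Upper bound: a sequence of length L with 2^L > 9n has two distinct subsets with the same
-- sum (pigeonhole), and the difference of the two subsets is a ±1-weighted zero sum.
-- Lower bound: signed binary expansions Σ cᵢ 2^i with cᵢ ∈ {-1, 0, 1} are smaller than 2^p
-- in absolute value and vanish only trivially. Hence (1, 0), (0, 1), (0, 2), …, (0, 2^(k-1))
-- has no signed zero sum when 2^k ≤ 3n, as ±1 is not divisible by 3. Prefixing the powers
-- (0, 2^i), i < p, with the coset (1, a), (1, a + n), (1, a + 2n), where a = ⌊n/2⌋ and
-- 2^p ≤ n, also works: a signed combination of the coset with first coordinate 0 mod 3 is
-- ≡ 0, ±3a, ±n or ±2n mod 3n, and a signed binary sum of absolute value below 2^p cannot
-- cancel the nonzero ones. Each of the two alternatives of the hypothesis makes one of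
-- these sequences as long as ⌊log₂ 9n⌋.

module Submission where

open import Defs
open import Data.Bool.Base using (Bool; true; false; if_then_else_)
open import Data.Fin.Base using (Fin; zero; suc; toℕ; fromℕ<; combine; finToFun; funToFin)
open import Data.Fin.Properties
  using (_≟_; toℕ<n; toℕ-injective; toℕ-fromℕ<; fromℕ<-injective; combine-injective;
         funToFin-finToFin; pigeonhole; <⇒≢; ¬∀⟶∃¬)
open import Data.Fin.Subset using (Subset; _∈_)
open import Data.Integer.Base using (ℤ; +_; -[1+_]; ∣_∣; _+_; _-_; _*_; -_; 0ℤ; _%ℕ_; _/ℕ_)
open import Data.Integer.DivMod using (n%ℕd<d; a≡a%ℕn+[a/ℕn]*n)
open import Data.Integer.Divisibility.Signed using (_∣_; divides; ∣⇒∣ᵤ; ∣ᵤ⇒∣; ∣m+n∣n⇒∣m; *-monoˡ-∣)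
open import Data.Integer.Properties
  using (+-0-abelianGroup; +-identityˡ; +-identityʳ; *-identityʳ; *-zeroʳ; +-injective; i-j≡0⇒i≡j;
         pos-*; abs-*; ∣i+j∣≤∣i∣+∣j∣; ∣-i∣≡∣i∣; ∣i∣≡0⇒i≡0)
open import Data.Integer.Tactic.RingSolver using (solve-∀)
open import Data.List.Base using (List; []; _∷_)
open import Data.List.Membership.Propositional using () renaming (_∈_ to _∈ₗ_)
open import Data.List.Relation.Unary.All as All using (All; all?)
open import Data.List.Relation.Unary.Any using (here; there)
open import Data.Nat.Base as ℕ using (ℕ; _≤_; _<_; _^_; z≤n; s≤s; NonZero; ⌊_/2⌋)
open import Data.Nat.Divisibility using (>⇒∤) renaming (_∣_ to _∣ℕ_; _∣?_ to _∣ℕ?_)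
open import Data.Nat.Logarithm using (⌊log₂_⌋; ⌊log₂⌋-mono-≤; ⌊log₂[2^n]⌋≡n; ⌊log₂⌊n/2⌋⌋≡⌊log₂n⌋∸1)
import Data.Nat.Properties as ℕ
open import Data.Product.Base using (Σ; _×_; _,_; proj₁; proj₂; ∃; ∃-syntax)
open import Data.Sum.Base using (_⊎_; inj₁; inj₂; [_,_]′)
open import Data.Vec.Base using (lookup; tabulate)
open import Data.Vec.Functional using () renaming (_∷_ to _◂_)
open import Data.Vec.Properties using (lookup∘tabulate; lookup⇒[]=; []=⇒lookup)
open import Function.Base using (_∘_)
open import Function.Bundles using (_⇔_; mk⇔; Equivalence)
open import Relation.Binary.PropositionalEquality
open import Relation.Nullary.Decidable using (Dec; from-yes; _×-dec_; _⊎-dec_; _→-dec_)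
open import Relation.Nullary.Negation using (¬_; contradiction)

open import Algebra.Properties.AbelianGroup +-0-abelianGroup using (inverseˡ-unique)

-- Signed sums

Σℤ-cong : ∀ {k} {f g : Fin k → ℤ} → (∀ i → f i ≡ g i) → Σℤ f ≡ Σℤ g
Σℤ-cong {ℕ.zero} f≗g = refl
Σℤ-cong {ℕ.suc k} f≗g = cong₂ _+_ (f≗g zero) (Σℤ-cong (f≗g ∘ suc))

infixl 7 _·_
_·_ : ∀ {k} → (Fin k → ℤ) → (Fin k → ℕ) → ℤ
c · x = Σℤ (λ i → c i * + x i)

·-congˡ : ∀ {k} (c : Fin k → ℤ) {x y : Fin k → ℕ} → (∀ i → x i ≡ y i) → c · x ≡ c · y
·-congˡ c x≗y = Σℤ-cong (λ i → cong (λ n → c i * + n) (x≗y i))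

·-congʳ : ∀ {k} {c d : Fin k → ℤ} (x : Fin k → ℕ) → (∀ i → c i ≡ d i) → c · x ≡ d · x
·-congʳ x c≗d = Σℤ-cong (λ i → cong (_* + x i) (c≗d i))

·-distribʳ-‿- : ∀ {k} (c d : Fin k → ℤ) x → (λ i → c i - d i) · x ≡ c · x - d · x
·-distribʳ-‿- {ℕ.zero} c d x = refl
·-distribʳ-‿- {ℕ.suc k} c d x =
  trans (cong (_+_ ((c zero - d zero) * + x zero)) (·-distribʳ-‿- (c ∘ suc) (d ∘ suc) (x ∘ suc)))
        (regroup (c zero) (d zero) (+ x zero) ((c ∘ suc) · (x ∘ suc)) ((d ∘ suc) · (x ∘ suc)))
  where
  regroup : ∀ a b x s t → (a - b) * x + (s - t) ≡ (a * x + s) - (b * x + t)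
  regroup = solve-∀

·-zeroʳ : ∀ {k} (c : Fin k → ℤ) → c · (λ _ → 0) ≡ 0ℤ
·-zeroʳ {ℕ.zero} c = refl
·-zeroʳ {ℕ.suc k} c = cong₂ _+_ (*-zeroʳ (c zero)) (·-zeroʳ (c ∘ suc))

·-*ʳ : ∀ {k} m (c : Fin k → ℤ) x → c · (λ i → m ℕ.* x i) ≡ + m * (c · x)
·-*ʳ {ℕ.zero} m c x = sym (*-zeroʳ (+ m))
·-*ʳ {ℕ.suc k} m c x = begin
  c zero * + (m ℕ.* x zero) + (c ∘ suc) · (λ i → m ℕ.* x (suc i))
    ≡⟨ cong₂ _+_ (cong (c zero *_) (pos-* m (x zero))) (·-*ʳ m (c ∘ suc) (x ∘ suc)) ⟩
  c zero * (+ m * + x zero) + + m * ((c ∘ suc) · (x ∘ suc))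
    ≡⟨ factor (c zero) (+ m) (+ x zero) ((c ∘ suc) · (x ∘ suc)) ⟩
  + m * (c zero * + x zero + (c ∘ suc) · (x ∘ suc)) ∎
  where
  open ≡-Reasoning
  factor : ∀ a m x s → a * (m * x) + m * s ≡ m * (a * x + s)
  factor = solve-∀

i%ℕm≡j%ℕm⇒m∣i-j : ∀ {m} .{{_ : NonZero m}} i j → i %ℕ m ≡ j %ℕ m → + m ∣ i - j
i%ℕm≡j%ℕm⇒m∣i-j {m} i j i%m≡j%m = divides (i /ℕ m - j /ℕ m) (begin
  i - j
    ≡⟨ cong₂ _-_ (a≡a%ℕn+[a/ℕn]*n i m) (a≡a%ℕn+[a/ℕn]*n j m) ⟩
  (+ (i %ℕ m) + i /ℕ m * + m) - (+ (j %ℕ m) + j /ℕ m * + m)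
    ≡⟨ cong (λ r → (+ (i %ℕ m) + i /ℕ m * + m) - (+ r + j /ℕ m * + m)) i%m≡j%m ⟨
  (+ (i %ℕ m) + i /ℕ m * + m) - (+ (i %ℕ m) + j /ℕ m * + m)
    ≡⟨ cancel (+ (i %ℕ m)) (i /ℕ m) (j /ℕ m) (+ m) ⟩
  (i /ℕ m - j /ℕ m) * + m ∎)
  where
  open ≡-Reasoning
  cancel : ∀ r q q′ m → (r + q * m) - (r + q′ * m) ≡ (q - q′) * m
  cancel = solve-∀

m∣i∧∣i∣<m⇒i≡0 : ∀ {m i} → + m ∣ i → ∣ i ∣ < m → i ≡ 0ℤ
m∣i∧∣i∣<m⇒i≡0 {i = + ℕ.zero}  _   _     = refl
m∣i∧∣i∣<m⇒i≡0 {i = + ℕ.suc _} m∣i ∣i∣<m = contradiction (∣⇒∣ᵤ m∣i) (>⇒∤ ∣i∣<m)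
m∣i∧∣i∣<m⇒i≡0 {i = -[1+ _ ]}  m∣i ∣i∣<m = contradiction (∣⇒∣ᵤ m∣i) (>⇒∤ ∣i∣<m)

i+j≡0⇒∣i∣≡∣j∣ : ∀ i j → i + j ≡ 0ℤ → ∣ i ∣ ≡ ∣ j ∣
i+j≡0⇒∣i∣≡∣j∣ i j i+j≡0 = trans (cong ∣_∣ (inverseˡ-unique i j i+j≡0)) (∣-i∣≡∣i∣ j)

∤r+s : ∀ {m d} r s → d ≤ ∣ r ∣ → ∣ r ∣ ℕ.+ d ≤ m → ∣ s ∣ < d → ¬ (+ m ∣ r + s)
∤r+s {d = d} r s d≤∣r∣ ∣r∣+d≤m ∣s∣<d m∣r+s =
  ℕ.<⇒≱ ∣s∣<d (subst (d ≤_) (i+j≡0⇒∣i∣≡∣j∣ r s r+s≡0) d≤∣r∣)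
  where
  r+s≡0 : r + s ≡ 0ℤ
  r+s≡0 = m∣i∧∣i∣<m⇒i≡0 m∣r+s (ℕ.≤-<-trans (∣i+j∣≤∣i∣+∣j∣ r s)
            (ℕ.<-≤-trans (ℕ.+-monoʳ-< ∣ r ∣ ∣s∣<d) ∣r∣+d≤m))

-- Signed binary expansions

IsSignVector : ∀ {k} → (Fin k → ℤ) → Set
IsSignVector c = ∀ i → ∣ c i ∣ ≤ 1

powers : ∀ {p} → Fin p → ℕ
powers i = 2 ^ toℕ i

·powers-suc : ∀ {p} (c : Fin (ℕ.suc p) → ℤ) → c · powers ≡ c zero + + 2 * ((c ∘ suc) · powers)
·powers-suc c = cong₂ _+_ (*-identityʳ (c zero)) (·-*ʳ 2 (c ∘ suc) powers)

∣c·powers∣<2^p : ∀ {p} (c : Fin p → ℤ) → IsSignVector c → ∣ c · powers ∣ < 2 ^ p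
∣c·powers∣<2^p {ℕ.zero} c _ = s≤s z≤n
∣c·powers∣<2^p {ℕ.suc p} c sc = begin-strict
  ∣ c · powers ∣               ≡⟨ cong ∣_∣ (·powers-suc c) ⟩
  ∣ c zero + + 2 * S ∣         ≤⟨ ∣i+j∣≤∣i∣+∣j∣ (c zero) (+ 2 * S) ⟩
  ∣ c zero ∣ ℕ.+ ∣ + 2 * S ∣   ≡⟨ cong (∣ c zero ∣ ℕ.+_) (abs-* (+ 2) S) ⟩
  ∣ c zero ∣ ℕ.+ 2 ℕ.* ∣ S ∣   ≤⟨ ℕ.+-monoˡ-≤ (2 ℕ.* ∣ S ∣) (sc zero) ⟩
  1 ℕ.+ 2 ℕ.* ∣ S ∣            <⟨ ℕ.n<1+n _ ⟩
  2 ℕ.+ 2 ℕ.* ∣ S ∣            ≡⟨ ℕ.*-suc 2 ∣ S ∣ ⟨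
  2 ℕ.* ℕ.suc ∣ S ∣            ≤⟨ ℕ.*-monoʳ-≤ 2 (∣c·powers∣<2^p (c ∘ suc) (sc ∘ suc)) ⟩
  2 ℕ.* 2 ^ p                  ∎
  where
  open ℕ.≤-Reasoning
  S = (c ∘ suc) · powers

c·powers≡0⇒c≡0 : ∀ {p} (c : Fin p → ℤ) → IsSignVector c → c · powers ≡ 0ℤ → ∀ i → c i ≡ 0ℤ
c·powers≡0⇒c≡0 {ℕ.suc p} c sc c·powers≡0 = λ
  { zero → c₀≡0
  ; (suc i) → c·powers≡0⇒c≡0 (c ∘ suc) (sc ∘ suc) S≡0 i }
  where
  S = (c ∘ suc) · powers
  c₀+2S≡0 : c zero + + 2 * S ≡ 0ℤ
  c₀+2S≡0 = trans (sym (·powers-suc c)) c·powers≡0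
  S≡0 : S ≡ 0ℤ
  S≡0 = ∣i∣≡0⇒i≡0 (ℕ.n<1⇒n≡0 (ℕ.*-cancelˡ-< 2 ∣ S ∣ 1 (s≤s (begin
    2 ℕ.* ∣ S ∣   ≡⟨ abs-* (+ 2) S ⟨
    ∣ + 2 * S ∣   ≡⟨ i+j≡0⇒∣i∣≡∣j∣ (c zero) (+ 2 * S) c₀+2S≡0 ⟨
    ∣ c zero ∣    ≤⟨ sc zero ⟩
    1             ∎))))
    where open ℕ.≤-Reasoning
  c₀≡0 : c zero ≡ 0ℤ
  c₀≡0 = trans (sym (+-identityʳ (c zero))) (subst (λ s → c zero + + 2 * s ≡ 0ℤ) S≡0 c₀+2S≡0)

m∣c·powers⇒c≡0 : ∀ {p m} (c : Fin p → ℤ) → IsSignVector c → 2 ^ p ≤ m → + m ∣ c · powers → ∀ i → c i ≡ 0ℤ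
m∣c·powers⇒c≡0 c sc 2^p≤m m∣c·powers = c·powers≡0⇒c≡0 c sc
  (m∣i∧∣i∣<m⇒i≡0 m∣c·powers (ℕ.<-≤-trans (∣c·powers∣<2^p c sc) 2^p≤m))

-- Signed zero sums as relations with sign-vector coefficients

IsRelation : ∀ {k} → ℕ → ℕ → (Fin k → ℕ) → (Fin k → ℕ) → (Fin k → ℤ) → Set
IsRelation m₁ m₂ x y c = (+ m₁ ∣ c · x) × (+ m₂ ∣ c · y)

NontrivialSignedRelation : ∀ {k} → ℕ → ℕ → (Fin k → ℕ) → (Fin k → ℕ) → Set
NontrivialSignedRelation m₁ m₂ x y =
  ∃ λ c → IsSignVector c × IsRelation m₁ m₂ x y c × ∃ λ i → c i ≢ 0ℤ

NontrivialSignedRelation-cong : ∀ {k m₁ m₂} {x x′ y y′ : Fin k → ℕ} →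
  (∀ i → x i ≡ x′ i) → (∀ i → y i ≡ y′ i) →
  NontrivialSignedRelation m₁ m₂ x y → NontrivialSignedRelation m₁ m₂ x′ y′
NontrivialSignedRelation-cong {m₁ = m₁} {m₂} x≗x′ y≗y′ (c , sc , (m₁∣ , m₂∣) , nontrivial) =
  c , sc , (subst (+ m₁ ∣_) (·-congˡ c x≗x′) m₁∣ , subst (+ m₂ ∣_) (·-congˡ c y≗y′) m₂∣) , nontrivial

coef-isSignVector : ∀ {k} (I : Subset k) ε → IsSignVector (coef I ε)
coef-isSignVector I ε i with lookup I i | ε i
... | false | _     = z≤n
... | true  | true  = s≤s z≤n
... | true  | false = s≤s z≤n

coef-≢0 : ∀ {k} (I : Subset k) ε {i} → i ∈ I → coef I ε i ≢ 0ℤ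
coef-≢0 I ε {i} i∈I rewrite []=⇒lookup i∈I with ε i
... | true  = λ ()
... | false = λ ()

isNonzero : ℤ → Bool
isNonzero (+ ℕ.zero) = false
isNonzero _          = true

isPositive : ℤ → Bool
isPositive (+ _)      = true
isPositive -[1+ _ ]   = false

support : ∀ {k} → (Fin k → ℤ) → Subset k
support c = tabulate (isNonzero ∘ c)

coef-support : ∀ {k} (c : Fin k → ℤ) → IsSignVector c → ∀ i → coef (support c) (isPositive ∘ c) i ≡ c i
coef-support c sc i rewrite lookup∘tabulate (isNonzero ∘ c) i = decode (c i) (sc i)
  where
  decode : ∀ a → ∣ a ∣ ≤ 1 → (if isNonzero a then (if isPositive a then + 1 else - + 1) else + 0) ≡ a
  decode (+ 0)               _         = refl
  decode (+ 1)               _         = refl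
  decode -[1+ 0 ]            _         = refl
  decode (+ ℕ.suc (ℕ.suc _)) (s≤s ())
  decode -[1+ ℕ.suc _ ]      (s≤s ())

∈-support : ∀ {k} (c : Fin k → ℤ) {i} → c i ≢ 0ℤ → i ∈ support c
∈-support c {i} ci≢0 = lookup⇒[]= i (support c) (trans (lookup∘tabulate (isNonzero ∘ c) i) (nonzero (c i) ci≢0))
  where
  nonzero : ∀ a → a ≢ 0ℤ → isNonzero a ≡ true
  nonzero (+ ℕ.zero)  a≢0 = contradiction refl a≢0
  nonzero (+ ℕ.suc _) _   = refl
  nonzero -[1+ _ ]    _   = refl

HasPMZeroSum⇔NontrivialSignedRelation : ∀ {k m₁ m₂} (g : Fin k → Elem m₁ m₂) →
  HasPMZeroSum g ⇔ NontrivialSignedRelation m₁ m₂ (toℕ ∘ proj₁ ∘ g) (toℕ ∘ proj₂ ∘ g)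
HasPMZeroSum⇔NontrivialSignedRelation {m₁ = m₁} {m₂} g = mk⇔
  (λ (I , (i , i∈I) , ε , m₁∣ , m₂∣) →
     coef I ε , coef-isSignVector I ε , (∣ᵤ⇒∣ m₁∣ , ∣ᵤ⇒∣ m₂∣) , i , coef-≢0 I ε i∈I)
  (λ (c , sc , (m₁∣ , m₂∣) , i , ci≢0) →
     support c , (i , ∈-support c ci≢0) , isPositive ∘ c ,
     ∣⇒∣ᵤ (subst (+ m₁ ∣_) (sym (·-congʳ _ (coef-support c sc))) m₁∣) ,
     ∣⇒∣ᵤ (subst (+ m₂ ∣_) (sym (·-congʳ _ (coef-support c sc))) m₂∣))

n<2^[1+⌊log₂n⌋] : ∀ n → n < 2 ^ ℕ.suc ⌊log₂ n ⌋
n<2^[1+⌊log₂n⌋] n = ℕ.≰⇒> λ 2^[1+L]≤n →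
  ℕ.n≮n ⌊log₂ n ⌋ (subst (_≤ ⌊log₂ n ⌋) (⌊log₂[2^n]⌋≡n (ℕ.suc ⌊log₂ n ⌋)) (⌊log₂⌋-mono-≤ 2^[1+L]≤n))

2*⌊n/2⌋≤n : ∀ n → 2 ℕ.* ⌊ n /2⌋ ≤ n
2*⌊n/2⌋≤n 0                 = z≤n
2*⌊n/2⌋≤n 1                 = z≤n
2*⌊n/2⌋≤n (ℕ.suc (ℕ.suc n)) = subst (_≤ 2 ℕ.+ n) (sym (ℕ.*-suc 2 ⌊ n /2⌋)) (s≤s (s≤s (2*⌊n/2⌋≤n n)))

n≤1+2*⌊n/2⌋ : ∀ n → n ≤ 1 ℕ.+ 2 ℕ.* ⌊ n /2⌋
n≤1+2*⌊n/2⌋ 0                 = z≤n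
n≤1+2*⌊n/2⌋ 1                 = s≤s z≤n
n≤1+2*⌊n/2⌋ (ℕ.suc (ℕ.suc n)) = subst (2 ℕ.+ n ≤_) (cong ℕ.suc (sym (ℕ.*-suc 2 ⌊ n /2⌋))) (s≤s (s≤s (n≤1+2*⌊n/2⌋ n)))

⌊log₂n⌋≡j⇒2^j≤n : ∀ j {n} → 1 ≤ n → ⌊log₂ n ⌋ ≡ j → 2 ^ j ≤ n
⌊log₂n⌋≡j⇒2^j≤n 0         1≤n _ = 1≤n
⌊log₂n⌋≡j⇒2^j≤n (ℕ.suc j) {ℕ.suc (ℕ.suc n)} _ ⌊log₂n⌋≡1+j = begin
  2 ℕ.* 2 ^ j                   ≤⟨ ℕ.*-monoʳ-≤ 2 (⌊log₂n⌋≡j⇒2^j≤n j (s≤s z≤n) ⌊log₂⌊n/2⌋⌋≡j) ⟩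
  2 ℕ.* ⌊ ℕ.suc (ℕ.suc n) /2⌋   ≤⟨ 2*⌊n/2⌋≤n (ℕ.suc (ℕ.suc n)) ⟩
  ℕ.suc (ℕ.suc n)               ∎
  where
  open ℕ.≤-Reasoning
  ⌊log₂⌊n/2⌋⌋≡j : ⌊log₂ ⌊ ℕ.suc (ℕ.suc n) /2⌋ ⌋ ≡ j
  ⌊log₂⌊n/2⌋⌋≡j = trans (⌊log₂⌊n/2⌋⌋≡⌊log₂n⌋∸1 (ℕ.suc (ℕ.suc n))) (cong (ℕ._∸ 1) ⌊log₂n⌋≡1+j)

2^⌊log₂n⌋≤n : ∀ {n} → 1 ≤ n → 2 ^ ⌊log₂ n ⌋ ≤ n
2^⌊log₂n⌋≤n 1≤n = ⌊log₂n⌋≡j⇒2^j≤n _ 1≤n refl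

m<2^[1+n]⇒⌊log₂m⌋≤n : ∀ {m n} → 1 ≤ m → m < 2 ^ ℕ.suc n → ⌊log₂ m ⌋ ≤ n
m<2^[1+n]⇒⌊log₂m⌋≤n 1≤m m<2^[1+n] = ℕ.≤-pred (ℕ.≰⇒> λ 1+n≤⌊log₂m⌋ →
  ℕ.<⇒≱ m<2^[1+n] (ℕ.≤-trans (ℕ.^-monoʳ-≤ 2 1+n≤⌊log₂m⌋) (2^⌊log₂n⌋≤n 1≤m)))

m<2^j⇒3m<2^[2+j] : ∀ {m j} → m < 2 ^ j → 3 ℕ.* m < 2 ^ (2 ℕ.+ j)
m<2^j⇒3m<2^[2+j] {m} {j} m<2^j = begin-strict
  3 ℕ.* m            <⟨ ℕ.*-monoʳ-< 3 m<2^j ⟩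
  3 ℕ.* 2 ^ j        ≤⟨ ℕ.*-monoˡ-≤ (2 ^ j) (ℕ.n≤1+n 3) ⟩
  4 ℕ.* 2 ^ j        ≡⟨ ℕ.*-assoc 2 2 (2 ^ j) ⟩
  2 ^ (2 ℕ.+ j)      ∎
  where open ℕ.≤-Reasoning

n≤3*⌊n/2⌋ : ∀ {n} → 2 ≤ n → n ≤ 3 ℕ.* ⌊ n /2⌋
n≤3*⌊n/2⌋ {n} 2≤n = ℕ.≤-trans (n≤1+2*⌊n/2⌋ n) (ℕ.+-monoˡ-≤ (2 ℕ.* ⌊ n /2⌋) (ℕ.⌊n/2⌋-mono 2≤n))

3*⌊n/2⌋≤2*n : ∀ n → 3 ℕ.* ⌊ n /2⌋ ≤ 2 ℕ.* n
3*⌊n/2⌋≤2*n n = ℕ.≤-trans (ℕ.+-mono-≤ (ℕ.⌊n/2⌋≤n n) (2*⌊n/2⌋≤n n))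
                          (ℕ.≤-reflexive (cong (n ℕ.+_) (sym (ℕ.+-identityʳ n))))

-- Subset sums and the upper bound

bits : ∀ {k} → (Fin k → Fin 2) → Fin k → ℤ
bits u i = + toℕ (u i)

∣bit-bit∣≤1 : ∀ (a b : Fin 2) → ∣ + toℕ a - + toℕ b ∣ ≤ 1
∣bit-bit∣≤1 zero       zero       = z≤n
∣bit-bit∣≤1 zero       (suc zero) = s≤s z≤n
∣bit-bit∣≤1 (suc zero) zero       = s≤s z≤n
∣bit-bit∣≤1 (suc zero) (suc zero) = z≤n

congruent-subsets⇒relation : ∀ {k m₁ m₂} .{{_ : NonZero m₁}} .{{_ : NonZero m₂}}
  (x y : Fin k → ℕ) (u v : Fin k → Fin 2) →
  (bits u · x) %ℕ m₁ ≡ (bits v · x) %ℕ m₁ → (bits u · y) %ℕ m₂ ≡ (bits v · y) %ℕ m₂ →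
  ∀ t → u t ≢ v t → NontrivialSignedRelation m₁ m₂ x y
congruent-subsets⇒relation {m₁ = m₁} {m₂} x y u v ≡₁ ≡₂ t ut≢vt =
  (λ i → bits u i - bits v i) , (λ i → ∣bit-bit∣≤1 (u i) (v i)) ,
  ( subst (+ m₁ ∣_) (sym (·-distribʳ-‿- (bits u) (bits v) x)) (i%ℕm≡j%ℕm⇒m∣i-j (bits u · x) (bits v · x) ≡₁)
  , subst (+ m₂ ∣_) (sym (·-distribʳ-‿- (bits u) (bits v) y)) (i%ℕm≡j%ℕm⇒m∣i-j (bits u · y) (bits v · y) ≡₂)) ,
  t , ut≢vt ∘ toℕ-injective ∘ +-injective ∘ i-j≡0⇒i≡j (bits u t) (bits v t)

funToFin-cong : ∀ {m n} {f g : Fin m → Fin n} → (∀ i → f i ≡ g i) → funToFin f ≡ funToFin g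
funToFin-cong {ℕ.zero}  _   = refl
funToFin-cong {ℕ.suc m} f≗g = cong₂ combine (f≗g zero) (funToFin-cong (f≗g ∘ suc))

finToFun-injective : ∀ {m n} {i j : Fin (n ^ m)} → (∀ t → finToFun {n} {m} i t ≡ finToFun j t) → i ≡ j
finToFun-injective {m} {n} {i} {j} i≗j = begin
  i                               ≡⟨ funToFin-finToFin {m} {n} i ⟨
  funToFin (finToFun {n} {m} i)   ≡⟨ funToFin-cong i≗j ⟩
  funToFin (finToFun {n} {m} j)   ≡⟨ funToFin-finToFin {m} {n} j ⟩
  j                               ∎
  where open ≡-Reasoning

subsetSumResidues : ∀ {k} m₁ m₂ .{{_ : NonZero m₁}} .{{_ : NonZero m₂}} →
  (Fin k → ℕ) → (Fin k → ℕ) → Fin (2 ^ k) → Fin (m₁ ℕ.* m₂)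
subsetSumResidues m₁ m₂ x y s = combine (fromℕ< (n%ℕd<d (bits (finToFun s) · x) m₁))
                                        (fromℕ< (n%ℕd<d (bits (finToFun s) · y) m₂))

pigeonhole-relation : ∀ {k m₁ m₂} .{{_ : NonZero m₁}} .{{_ : NonZero m₂}} →
  m₁ ℕ.* m₂ < 2 ^ k → (x y : Fin k → ℕ) → NontrivialSignedRelation m₁ m₂ x y
pigeonhole-relation {k} {m₁} {m₂} m₁m₂<2^k x y
  with s , s′ , s<s′ , same ← pigeonhole m₁m₂<2^k (subsetSumResidues m₁ m₂ x y)
  with t , differ ← ¬∀⟶∃¬ k _ (λ t → finToFun s t ≟ finToFun s′ t) (<⇒≢ s<s′ ∘ finToFun-injective {k} {2})
  = congruent-subsets⇒relation x y (finToFun s) (finToFun s′)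
      (fromℕ<-injective _ _ _ _ (proj₁ (combine-injective {m = m₁} {n = m₂} _ _ _ _ same)))
      (fromℕ<-injective _ _ _ _ (proj₂ (combine-injective {m = m₁} {n = m₂} _ _ _ _ same)))
      t differ

pmProperty-1+⌊log₂m₁m₂⌋ : ∀ m₁ m₂ .{{_ : NonZero m₁}} .{{_ : NonZero m₂}} →
  PMProperty m₁ m₂ (ℕ.suc ⌊log₂ (m₁ ℕ.* m₂) ⌋)
pmProperty-1+⌊log₂m₁m₂⌋ m₁ m₂ k 1+L≤k g = Equivalence.from (HasPMZeroSum⇔NontrivialSignedRelation g)
  (pigeonhole-relation (ℕ.<-≤-trans (n<2^[1+⌊log₂n⌋] (m₁ ℕ.* m₂)) (ℕ.^-monoʳ-≤ 2 1+L≤k)) _ _)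

-- Zero-sum-free sequences

ZeroSumFreeSequence : ℕ → ℕ → ℕ → Set
ZeroSumFreeSequence m₁ m₂ L = Σ (Fin L → Elem m₁ m₂) (¬_ ∘ HasPMZeroSum)

LongZeroSumFreeSequence : ℕ → ℕ → ℕ → Set
LongZeroSumFreeSequence m₁ m₂ K = ∃[ L ] K ≤ L × ZeroSumFreeSequence m₁ m₂ L

long-zeroSumFree⇒¬PMProperty : ∀ {m₁ m₂ K ℓ} → LongZeroSumFreeSequence m₁ m₂ K → ℓ ≤ K →
  ¬ PMProperty m₁ m₂ ℓ
long-zeroSumFree⇒¬PMProperty (L , K≤L , g , free) ℓ≤K P = free (P L (ℕ.≤-trans ℓ≤K K≤L) g)

powers<m : ∀ {p m} → 2 ^ p ≤ m → ∀ i → powers {p} i < m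
powers<m 2^p≤m i = ℕ.<-≤-trans (ℕ.^-monoʳ-< 2 (s≤s (s≤s z≤n)) (toℕ<n i)) 2^p≤m

fromRepresentatives : ∀ {k m₁ m₂} (x y : Fin k → ℕ) → (∀ i → x i < m₁) → (∀ i → y i < m₂) →
  Fin k → Elem m₁ m₂
fromRepresentatives x y x<m₁ y<m₂ i = fromℕ< (x<m₁ i) , fromℕ< (y<m₂ i)

fromRepresentatives-zeroSumFree : ∀ {k m₁ m₂} {x y : Fin k → ℕ}
  (x<m₁ : ∀ i → x i < m₁) (y<m₂ : ∀ i → y i < m₂) →
  ¬ NontrivialSignedRelation m₁ m₂ x y → ¬ HasPMZeroSum (fromRepresentatives x y x<m₁ y<m₂)
fromRepresentatives-zeroSumFree x<m₁ y<m₂ noRelation =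
  noRelation ∘ NontrivialSignedRelation-cong (λ i → toℕ-fromℕ< (x<m₁ i)) (λ i → toℕ-fromℕ< (y<m₂ i))
             ∘ Equivalence.to (HasPMZeroSum⇔NontrivialSignedRelation _)

no-relation-unit-powers : ∀ {k m} → 2 ^ k ≤ m → ¬ NontrivialSignedRelation 3 m (1 ◂ λ _ → 0) (0 ◂ powers {k})
no-relation-unit-powers {m = m} 2^k≤m (c , sc , (3∣ , m∣) , i , ci≢0) = ci≢0 (c≡0 i)
  where
  c₀≡0 : c zero ≡ 0ℤ
  c₀≡0 = m∣i∧∣i∣<m⇒i≡0
    (subst (+ 3 ∣_) (trans (cong₂ _+_ (*-identityʳ (c zero)) (·-zeroʳ (c ∘ suc))) (+-identityʳ (c zero))) 3∣)
    (ℕ.≤-<-trans (sc zero) (s≤s (s≤s z≤n)))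
  tail≡0 : ∀ i → c (suc i) ≡ 0ℤ
  tail≡0 = m∣c·powers⇒c≡0 (c ∘ suc) (sc ∘ suc) 2^k≤m
    (subst (+ m ∣_) (trans (cong (_+ (c ∘ suc) · powers) (*-zeroʳ (c zero))) (+-identityˡ _)) m∣)
  c≡0 : ∀ i → c i ≡ 0ℤ
  c≡0 zero    = c₀≡0
  c≡0 (suc i) = tail≡0 i

signs : List ℤ
signs = -[1+ 0 ] ∷ + 0 ∷ + 1 ∷ []

∣c∣≤1⇒c∈signs : ∀ {c} → ∣ c ∣ ≤ 1 → c ∈ₗ signs
∣c∣≤1⇒c∈signs { -[1+ 0 ]}           _        = here refl
∣c∣≤1⇒c∈signs {+ 0}                 _        = there (here refl)
∣c∣≤1⇒c∈signs {+ 1}                 _        = there (there (here refl))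
∣c∣≤1⇒c∈signs {+ ℕ.suc (ℕ.suc _)}   (s≤s ())
∣c∣≤1⇒c∈signs { -[1+ ℕ.suc _ ]}     (s≤s ())

FarShape : ℤ → ℤ → Set
FarShape s δ = (∣ s ∣ ≡ 3 × ∣ δ ∣ ≡ 0) ⊎ (∣ s ∣ ≡ 0 × 1 ≤ ∣ δ ∣ × ∣ δ ∣ ≤ 2)

-- A nonzero sign triple with 3 ∣ c₀ + c₁ + c₂ is constant or sums to 0 with c₀ ≠ c₂.
BalancedShape : ℤ → ℤ → ℤ → Set
BalancedShape c₀ c₁ c₂ =
  3 ∣ℕ ∣ c₀ + (c₁ + c₂) ∣ → (∣ c₀ ∣ ≡ 0 × ∣ c₁ ∣ ≡ 0 × ∣ c₂ ∣ ≡ 0) ⊎ FarShape (c₀ + (c₁ + c₂)) (c₂ - c₀)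

balancedShape? : ∀ c₀ c₁ c₂ → Dec (BalancedShape c₀ c₁ c₂)
balancedShape? c₀ c₁ c₂ =
  3 ∣ℕ? ∣ s ∣ →-dec
    ((∣ c₀ ∣ ℕ.≟ 0 ×-dec ∣ c₁ ∣ ℕ.≟ 0 ×-dec ∣ c₂ ∣ ℕ.≟ 0) ⊎-dec
     (∣ s ∣ ℕ.≟ 3 ×-dec ∣ δ ∣ ℕ.≟ 0) ⊎-dec
     (∣ s ∣ ℕ.≟ 0 ×-dec 1 ℕ.≤? ∣ δ ∣ ×-dec ∣ δ ∣ ℕ.≤? 2))
  where
  s = c₀ + (c₁ + c₂)
  δ = c₂ - c₀

balanced-sign-triple : ∀ c₀ c₁ c₂ → ∣ c₀ ∣ ≤ 1 → ∣ c₁ ∣ ≤ 1 → ∣ c₂ ∣ ≤ 1 → BalancedShape c₀ c₁ c₂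
balanced-sign-triple c₀ c₁ c₂ ∣c₀∣≤1 ∣c₁∣≤1 ∣c₂∣≤1 =
  All.lookup (All.lookup (All.lookup all-triples (∣c∣≤1⇒c∈signs {c₀} ∣c₀∣≤1))
                         (∣c∣≤1⇒c∈signs {c₁} ∣c₁∣≤1))
             (∣c∣≤1⇒c∈signs {c₂} ∣c₂∣≤1)
  where
  all-triples : All (λ c₀ → All (λ c₁ → All (BalancedShape c₀ c₁) signs) signs) signs
  all-triples = from-yes (all? (λ c₀ → all? (λ c₁ → all? (balancedShape? c₀ c₁) signs) signs) signs)

far-residue : ∀ {a n d} s δ → FarShape s δ → d ≤ n → d ≤ 3 ℕ.* a → 3 ℕ.* a ℕ.+ d ≤ 3 ℕ.* n →
  d ≤ ∣ s * + a + δ * + n ∣ × ∣ s * + a + δ * + n ∣ ℕ.+ d ≤ 3 ℕ.* n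
far-residue {a} {n} {d} s δ (inj₁ (∣s∣≡3 , ∣δ∣≡0)) _ d≤3a 3a+d≤3n =
  subst (d ≤_) (sym ∣r∣≡3a) d≤3a , subst (λ r → r ℕ.+ d ≤ 3 ℕ.* n) (sym ∣r∣≡3a) 3a+d≤3n
  where
  ∣r∣≡3a : ∣ s * + a + δ * + n ∣ ≡ 3 ℕ.* a
  ∣r∣≡3a = begin
    ∣ s * + a + δ * + n ∣  ≡⟨ cong (λ δ → ∣ s * + a + δ * + n ∣) (∣i∣≡0⇒i≡0 {δ} ∣δ∣≡0) ⟩
    ∣ s * + a + 0ℤ ∣       ≡⟨ cong ∣_∣ (+-identityʳ (s * + a)) ⟩
    ∣ s * + a ∣            ≡⟨ abs-* s (+ a) ⟩
    ∣ s ∣ ℕ.* a            ≡⟨ cong (ℕ._* a) ∣s∣≡3 ⟩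
    3 ℕ.* a                ∎
    where open ≡-Reasoning
far-residue {a} {n} {d} s δ (inj₂ (∣s∣≡0 , 1≤∣δ∣ , ∣δ∣≤2)) d≤n _ _ =
  subst (d ≤_) (sym ∣r∣≡∣δ∣n) (ℕ.≤-trans d≤n (ℕ.≤-trans (ℕ.≤-reflexive (sym (ℕ.*-identityˡ n))) (ℕ.*-monoˡ-≤ n 1≤∣δ∣))) ,
  subst (λ r → r ℕ.+ d ≤ 3 ℕ.* n) (sym ∣r∣≡∣δ∣n)
    (ℕ.≤-trans (ℕ.+-mono-≤ (ℕ.*-monoˡ-≤ n ∣δ∣≤2) d≤n) (ℕ.≤-reflexive (ℕ.+-comm (2 ℕ.* n) n)))
  where
  ∣r∣≡∣δ∣n : ∣ s * + a + δ * + n ∣ ≡ ∣ δ ∣ ℕ.* n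
  ∣r∣≡∣δ∣n = begin
    ∣ s * + a + δ * + n ∣  ≡⟨ cong (λ s → ∣ s * + a + δ * + n ∣) (∣i∣≡0⇒i≡0 {s} ∣s∣≡0) ⟩
    ∣ 0ℤ + δ * + n ∣       ≡⟨ cong ∣_∣ (+-identityˡ (δ * + n)) ⟩
    ∣ δ * + n ∣            ≡⟨ abs-* δ (+ n) ⟩
    ∣ δ ∣ ℕ.* n            ∎
    where open ≡-Reasoning

-- The coset contributes s (a + n) + δ n, and 3 n ∣ s n.
coset-relation : ∀ {p n a} c₀ c₁ c₂ (t : Fin p → ℤ) →
  IsRelation 3 (3 ℕ.* n) (1 ◂ 1 ◂ 1 ◂ λ _ → 0) (a ◂ a ℕ.+ n ◂ a ℕ.+ n ℕ.+ n ◂ powers) (c₀ ◂ c₁ ◂ c₂ ◂ t) →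
  (+ 3 ∣ c₀ + (c₁ + c₂)) × (+ (3 ℕ.* n) ∣ (c₀ + (c₁ + c₂)) * + a + (c₂ - c₀) * + n + t · powers)
coset-relation {n = n} {a} c₀ c₁ c₂ t (3∣ , 3n∣) =
  3∣s , ∣m+n∣n⇒∣m (subst (+ (3 ℕ.* n) ∣_) (regroup c₀ c₁ c₂ (+ a) (+ n) (t · powers)) 3n∣)
                  (subst (_∣ s * + n) (sym (pos-* 3 n)) (*-monoˡ-∣ (+ n) 3∣s))
  where
  s = c₀ + (c₁ + c₂)
  3∣s : + 3 ∣ s
  3∣s = subst (+ 3 ∣_)
    (cong₂ _+_ (*-identityʳ c₀) (cong₂ _+_ (*-identityʳ c₁)
      (trans (cong₂ _+_ (*-identityʳ c₂) (·-zeroʳ t)) (+-identityʳ c₂)))) 3∣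
  regroup : ∀ c₀ c₁ c₂ A N S →
    c₀ * A + (c₁ * (A + N) + (c₂ * (A + N + N) + S)) ≡
    ((c₀ + (c₁ + c₂)) * A + (c₂ - c₀) * N + S) + (c₀ + (c₁ + c₂)) * N
  regroup = solve-∀

no-relation-coset-powers : ∀ {p n a} → 2 ^ p ≤ n → 2 ^ p ≤ 3 ℕ.* a → 3 ℕ.* a ℕ.+ 2 ^ p ≤ 3 ℕ.* n →
  ¬ NontrivialSignedRelation 3 (3 ℕ.* n) (1 ◂ 1 ◂ 1 ◂ λ _ → 0) (a ◂ a ℕ.+ n ◂ a ℕ.+ n ℕ.+ n ◂ powers {p})
no-relation-coset-powers {n = n} {a} 2^p≤n 2^p≤3a 3a+2^p≤3n (c , sc , relation , i , ci≢0) = ci≢0 (c≡0 i)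
  where
  c₀ = c zero
  c₁ = c (suc zero)
  c₂ = c (suc (suc zero))
  tail = c ∘ suc ∘ suc ∘ suc
  s = c₀ + (c₁ + c₂)
  δ = c₂ - c₀
  r = s * + a + δ * + n
  S = tail · powers
  3∣s = proj₁ (coset-relation c₀ c₁ c₂ tail relation)
  3n∣r+S = proj₂ (coset-relation c₀ c₁ c₂ tail relation)
  heads≡0 : ∣ c₀ ∣ ≡ 0 × ∣ c₁ ∣ ≡ 0 × ∣ c₂ ∣ ≡ 0
  heads≡0 with balanced-sign-triple c₀ c₁ c₂ (sc zero) (sc (suc zero)) (sc (suc (suc zero))) (∣⇒∣ᵤ 3∣s)
  ... | inj₁ zero-heads = zero-heads
  ... | inj₂ far        = contradiction 3n∣r+S
    (∤r+s r S (proj₁ bounds) (proj₂ bounds) (∣c·powers∣<2^p tail (sc ∘ suc ∘ suc ∘ suc)))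
    where bounds = far-residue s δ far 2^p≤n 2^p≤3a 3a+2^p≤3n
  c₀≡0 = ∣i∣≡0⇒i≡0 {c₀} (proj₁ heads≡0)
  c₁≡0 = ∣i∣≡0⇒i≡0 {c₁} (proj₁ (proj₂ heads≡0))
  c₂≡0 = ∣i∣≡0⇒i≡0 {c₂} (proj₂ (proj₂ heads≡0))
  r≡0 : r ≡ 0ℤ
  r≡0 = cong₂ (λ s δ → s * + a + δ * + n) (cong₂ _+_ c₀≡0 (cong₂ _+_ c₁≡0 c₂≡0)) (cong₂ _-_ c₂≡0 c₀≡0)
  tail≡0 : ∀ i → tail i ≡ 0ℤ
  tail≡0 = m∣c·powers⇒c≡0 tail (sc ∘ suc ∘ suc ∘ suc) (ℕ.≤-trans 2^p≤n (ℕ.m≤n*m n 3))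
    (subst (+ (3 ℕ.* n) ∣_) (trans (cong (_+ S) r≡0) (+-identityˡ S)) 3n∣r+S)
  c≡0 : ∀ i → c i ≡ 0ℤ
  c≡0 zero                = c₀≡0
  c≡0 (suc zero)          = c₁≡0
  c≡0 (suc (suc zero))    = c₂≡0
  c≡0 (suc (suc (suc i))) = tail≡0 i

zeroSumFree-unit-powers : ∀ {k m} → 2 ^ k ≤ m → ZeroSumFreeSequence 3 m (ℕ.suc k)
zeroSumFree-unit-powers {k} 2^k≤m =
  fromRepresentatives _ _ x<3 y<m , fromRepresentatives-zeroSumFree x<3 y<m (no-relation-unit-powers 2^k≤m)
  where
  x<3 : ∀ i → (1 ◂ λ _ → 0) i < 3
  x<3 zero    = s≤s (s≤s z≤n)
  x<3 (suc _) = s≤s z≤n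
  y<m : ∀ i → (0 ◂ powers) i < _
  y<m zero    = ℕ.<-≤-trans (ℕ.m^n>0 2 k) 2^k≤m
  y<m (suc i) = powers<m 2^k≤m i

zeroSumFree-coset-powers : ∀ {p n a} → 2 ^ p ≤ n → n ≤ 3 ℕ.* a → 3 ℕ.* a ≤ 2 ℕ.* n →
  ZeroSumFreeSequence 3 (3 ℕ.* n) (3 ℕ.+ p)
zeroSumFree-coset-powers {p} {n} {a} 2^p≤n n≤3a 3a≤2n =
  fromRepresentatives _ _ x<3 y<3n ,
  fromRepresentatives-zeroSumFree x<3 y<3n (no-relation-coset-powers 2^p≤n (ℕ.≤-trans 2^p≤n n≤3a) 3a+2^p≤3n)
  where
  3a+2^p≤3n : 3 ℕ.* a ℕ.+ 2 ^ p ≤ 3 ℕ.* n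
  3a+2^p≤3n = ℕ.≤-trans (ℕ.+-mono-≤ 3a≤2n 2^p≤n) (ℕ.≤-reflexive (ℕ.+-comm (2 ℕ.* n) n))
  a<n : a < n
  a<n = ℕ.*-cancelˡ-< 3 a n (ℕ.≤-<-trans 3a≤2n (ℕ.+-monoˡ-< (2 ℕ.* n) (ℕ.<-≤-trans (ℕ.m^n>0 2 p) 2^p≤n)))
  a+n+n<3n : a ℕ.+ n ℕ.+ n < 3 ℕ.* n
  a+n+n<3n = begin-strict
    a ℕ.+ n ℕ.+ n            <⟨ ℕ.+-monoˡ-< n (ℕ.+-monoˡ-< n a<n) ⟩
    n ℕ.+ n ℕ.+ n            ≡⟨ ℕ.+-assoc n n n ⟩
    n ℕ.+ (n ℕ.+ n)          ≡⟨ cong (λ m → n ℕ.+ (n ℕ.+ m)) (ℕ.+-identityʳ n) ⟨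
    3 ℕ.* n                  ∎
    where open ℕ.≤-Reasoning
  x<3 : ∀ i → (1 ◂ 1 ◂ 1 ◂ λ _ → 0) i < 3
  x<3 zero                = s≤s (s≤s z≤n)
  x<3 (suc zero)          = s≤s (s≤s z≤n)
  x<3 (suc (suc zero))    = s≤s (s≤s z≤n)
  x<3 (suc (suc (suc _))) = s≤s z≤n
  y<3n : ∀ i → (a ◂ a ℕ.+ n ◂ a ℕ.+ n ℕ.+ n ◂ powers) i < 3 ℕ.* n
  y<3n zero                = ℕ.≤-<-trans (ℕ.≤-trans (ℕ.m≤m+n a n) (ℕ.m≤m+n (a ℕ.+ n) n)) a+n+n<3n
  y<3n (suc zero)          = ℕ.≤-<-trans (ℕ.m≤m+n (a ℕ.+ n) n) a+n+n<3n
  y<3n (suc (suc zero))    = a+n+n<3n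
  y<3n (suc (suc (suc i))) = powers<m (ℕ.≤-trans 2^p≤n (ℕ.m≤n*m n 3)) i

⌊log₂9n⌋≤ : ∀ {n j} → 1 ≤ n → 9 ℕ.* n < 2 ^ ℕ.suc j → ⌊log₂ (9 ℕ.* n) ⌋ ≤ j
⌊log₂9n⌋≤ {n} 1≤n = m<2^[1+n]⇒⌊log₂m⌋≤n (ℕ.≤-trans 1≤n (ℕ.m≤n*m n 9))

long-zeroSumFree₁ : ∀ {n} → 1 ≤ n → 9 ℕ.* n < 2 ^ (⌊log₂ (3 ℕ.* n) ⌋ ℕ.+ 2) →
  LongZeroSumFreeSequence 3 (3 ℕ.* n) ⌊log₂ (9 ℕ.* n) ⌋
long-zeroSumFree₁ {n} 1≤n 9n<2^[k+2] =
  ℕ.suc k , ⌊log₂9n⌋≤ {n} 1≤n (subst (λ j → 9 ℕ.* n < 2 ^ j) (ℕ.+-comm k 2) 9n<2^[k+2]) ,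
  zeroSumFree-unit-powers {k} (2^⌊log₂n⌋≤n {3 ℕ.* n} (ℕ.≤-trans 1≤n (ℕ.m≤n*m n 3)))
  where k = ⌊log₂ (3 ℕ.* n) ⌋

long-zeroSumFree₂ : ∀ {n} k → 2 ≤ n → 3 ℕ.* n < 2 ^ ℕ.suc k → 2 ^ k ≤ 2 ℕ.* n →
  LongZeroSumFreeSequence 3 (3 ℕ.* n) ⌊log₂ (9 ℕ.* n) ⌋
long-zeroSumFree₂ 0 (s≤s (s≤s _)) 3n<2 _ = contradiction 3n<2 (ℕ.≤⇒≯ (s≤s (s≤s z≤n)))
long-zeroSumFree₂ {n} (ℕ.suc p) 2≤n 3n<2^[2+p] 2^[1+p]≤2n =
  3 ℕ.+ p ,
  ⌊log₂9n⌋≤ {n} (ℕ.≤-trans (s≤s z≤n) 2≤n)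
    (subst (_< 2 ^ (4 ℕ.+ p)) (sym (ℕ.*-assoc 3 3 n)) (m<2^j⇒3m<2^[2+j] {j = 2 ℕ.+ p} 3n<2^[2+p])) ,
  zeroSumFree-coset-powers {a = ⌊ n /2⌋} (ℕ.*-cancelˡ-≤ 2 2^[1+p]≤2n) (n≤3*⌊n/2⌋ {n} 2≤n) (3*⌊n/2⌋≤2*n n)

theorem4p4 : (n : ℕ) → 2 ≤ n → FracCond n → IsDpm 3 (3 ℕ.* n) (⌊log₂ (9 ℕ.* n) ⌋ ℕ.+ 1)
theorem4p4 n 2≤n@(s≤s (s≤s _)) frac = ℕ.m≤n+m 1 K , upper , lower
  where
  K = ⌊log₂ (9 ℕ.* n) ⌋
  upper : PMProperty 3 (3 ℕ.* n) (K ℕ.+ 1)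
  upper = subst (PMProperty 3 (3 ℕ.* n))
                (trans (cong (λ m → ℕ.suc ⌊log₂ m ⌋) (sym (ℕ.*-assoc 3 3 n))) (ℕ.+-comm 1 K))
                (pmProperty-1+⌊log₂m₁m₂⌋ 3 (3 ℕ.* n))
  long : LongZeroSumFreeSequence 3 (3 ℕ.* n) K
  long = [ long-zeroSumFree₁ {n} (s≤s z≤n)
         , long-zeroSumFree₂ ⌊log₂ (3 ℕ.* n) ⌋ 2≤n (n<2^[1+⌊log₂n⌋] (3 ℕ.* n)) ]′ frac
  lower : ∀ ℓ → 1 ≤ ℓ → ℓ < K ℕ.+ 1 → ¬ PMProperty 3 (3 ℕ.* n) ℓ
  lower ℓ _ ℓ<K+1 = long-zeroSumFree⇒¬PMProperty long (ℕ.≤-pred (subst (ℓ <_) (ℕ.+-comm K 1) ℓ<K+1))
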